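{- Let $G=(V,E)$ be a directed graph with $n$ vertices, $(s,t)$ a vertex pair with $t$ reachable from $s$, and let $H_{(s,t)}$ be the subgraph defined in the context. Then $H_{(s,t)}$ is a 2-fault-tolerant reachability subgraph of $G$ for the pair $(s,t)$, i.e. for any set $F\subseteq E$ of at most two edges, $t$ is reachable from $s$ in $G\setminus F$ if and only if $t$ is reachable from $s$ in $H_{(s,t)}\setminus F$; moreover $H_{(s,t)}$ contains $O(n)$ edges.
   Context: For a path $P$ and vertices $u,v$ on $P$, write $u<_P v$ if $u$ appears before $v$ on $P$. An $s$–$t$ cut-edge (cut-vertex) is an edge (vertex) whose removal destroys all $s$ to $t$ paths. Fix two $s$ to $t$ paths $P^1,P^2$ (the outer strands) that intersect only at $s$–$t$ cut-edges and $s$–$t$ cut-vertices. For each vertex $v$ on $P^1\cup P^2$ and $i\in\{1,2\}$, the coupling point $u^i_v$ (if it exists) is the vertex $u$ of $P^i$ that is earliest on $P^i$ among those vertices from which there is a $u$ to $v$ path in $G$ edge-disjoint from both $P^1$ and $P^2$; the coupling path $Q^i_v$ is an arbitrarily fixed such $u^i_v$ to $v$ path edge-disjoint from $P^1$ and $P^2$. The subgraph $H_{(s,t)}$ has vertex set $V$ and contains all edges of $P^1$ and $P^2$, and, for every $i,j\in\{1,2\}$ and every $v\in V(P^j)$ having a coupling point $u^i_v$, contains all edges of $Q^i_v$ provided that for every vertex $v'$ appearing strictly after $v$ on $P^j$ that has a coupling point on $P^i$, we have $u^i_v<_{P^i}u^i_{v'}$. -}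

module Defs where

open import Data.Nat using (ℕ; _<_; _≤_; _*_)
open import Data.Fin using (Fin)
open import Data.Fin.Properties using ()
open import Data.List using (List; []; _∷_; length; lookup)
open import Data.List.Membership.Propositional using (_∈_; _∉_)
open import Data.List.Relation.Unary.Unique.Propositional using (Unique)
open import Data.Product using (Σ; ∃; _×_; _,_)
open import Data.Sum using (_⊎_)
open import Relation.Binary.PropositionalEquality using (_≡_)
open import Relation.Nullary using (¬_)
import Data.Fin as F

-- A directed graph on vertex set Fin n is given by its edge list E
-- (edges are ordered pairs; the graph is simple).
Edge : ℕ → Set
Edge n = Fin n × Fin n

EdgeSet : ℕ → Set₁
EdgeSet n = Edge n → Set

inList : ∀ {n} → List (Edge n) → EdgeSet n
inList E e = e ∈ E

_∖_ : ∀ {n} → EdgeSet n → List (Edge n) → EdgeSet n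
(R ∖ F) e = R e × e ∉ F

data PathIn {n} (R : EdgeSet n) : Fin n → Fin n → List (Fin n) → Set where
  single : ∀ v → PathIn R v v (v ∷ [])
  step   : ∀ {u w v vs} → R (u , w) → PathIn R w v vs → PathIn R u v (u ∷ vs)

IsPath : ∀ {n} → EdgeSet n → Fin n → Fin n → List (Fin n) → Set
IsPath R u v vs = PathIn R u v vs × Unique vs

Reach : ∀ {n} → EdgeSet n → Fin n → Fin n → Set
Reach R s t = ∃ λ vs → IsPath R s t vs

edgesOf : ∀ {n} → List (Fin n) → List (Edge n)
edgesOf []             = []
edgesOf (x ∷ [])       = []
edgesOf (x ∷ y ∷ xs)   = (x , y) ∷ edgesOf (y ∷ xs)

Before : ∀ {n} → List (Fin n) → Fin n → Fin n → Set
Before P u v = Σ (Fin (length P)) λ i → Σ (Fin (length P)) λ j →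
  (i F.< j) × (lookup P i ≡ u) × (lookup P j ≡ v)

module _ {n : ℕ} (E : List (Edge n)) (s t : Fin n) where

  G : EdgeSet n
  G = inList E

  CutEdge : Edge n → Set
  CutEdge e = e ∈ E × (∀ vs → IsPath G s t vs → e ∈ edgesOf vs)

  CutVertex : Fin n → Set
  CutVertex v = ∀ vs → IsPath G s t vs → v ∈ vs

  module Strands (P : Fin 2 → List (Fin n)) where

    OuterStrands : Set
    OuterStrands =
      (∀ i → IsPath G s t (P i)) ×
      (∀ v → v ∈ P F.zero → v ∈ P (F.suc F.zero) → CutVertex v) ×
      (∀ e → e ∈ edgesOf (P F.zero) → e ∈ edgesOf (P (F.suc F.zero)) → CutEdge e)

    EdgeDisjointFromStrands : List (Fin n) → Set
    EdgeDisjointFromStrands q = ∀ e → e ∈ edgesOf q → ∀ k → e ∉ edgesOf (P k)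

    DisjReach : Fin n → Fin n → Set
    DisjReach u v = ∃ λ q → IsPath G u v q × EdgeDisjointFromStrands q

    IsCouplingPoint : Fin 2 → Fin n → Fin n → Set
    IsCouplingPoint i v u =
      u ∈ P i × DisjReach u v ×
      (∀ u' → u' ∈ P i → DisjReach u' v → ¬ Before (P i) u' u)

    OnStrands : Fin n → Set
    OnStrands v = v ∈ P F.zero ⊎ v ∈ P (F.suc F.zero)

    CouplingPaths : (Fin 2 → Fin n → List (Fin n)) → Set
    CouplingPaths Q = ∀ i v u → OnStrands v → IsCouplingPoint i v u →
      IsPath G u v (Q i v) × EdgeDisjointFromStrands (Q i v)

    H : (Fin 2 → Fin n → List (Fin n)) → EdgeSet n
    H Q e =
      (Σ (Fin 2) λ k → e ∈ edgesOf (P k)) ⊎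
      (Σ (Fin 2) λ i → Σ (Fin 2) λ j → Σ (Fin n) λ v → Σ (Fin n) λ u →
        v ∈ P j × IsCouplingPoint i v u × e ∈ edgesOf (Q i v) ×
        (∀ v' u' → Before (P j) v v' → IsCouplingPoint i v' u' →
           Before (P i) u u'))

{-# OPTIONS --safe #-}

-- Every edge of H lies on a strand P^k or on a selected coupling path Q^i_v with
-- v on P^j, which splits H into six classes. Within a class an edge is determined by its
-- tail: the strands are paths, and two selected paths Q^i_v, Q^i_v′ (v before v′ on P^j)
-- cannot share a vertex, for then u^i_v would reach v′ edge-disjointly from the strands,
-- forcing u^i_v′ ≤ u^i_v against the selection rule u^i_v < u^i_v′. Hence |H| ≤ 6n.
--
-- H is a subgraph of G. Conversely, if a strand avoids F it survives in
-- H ∖ F. Otherwise each strand P^k loses an edge (a_k, b_k); it is not an s–t cut edge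
-- (the surviving path avoids it), so it lies on P^k only, and F consists of these two
-- edges. The part of P^k up to a_k (upstream) and from b_k on (downstream) survive in
-- H ∖ F. Walking along a surviving s–t path of G ∖ F from the upstream s to the downstream
-- t, either some vertex is upstream on one strand and downstream on another, or a segment
-- leads from an upstream x on P^i to a downstream y on P^j without touching strand edges.
-- Then y has a coupling point u ≤ x on P^i, and the latest vertex w ≥ y on P^j whose
-- coupling point is ≤ u is selected, giving s ⇝ u^i_w ⇝ w ⇝ t in H ∖ F.

module Submission where

open import Data.Empty using (⊥; ⊥-elim)
open import Data.Fin as Fin using (Fin)
open import Data.Fin.Properties using (_≟_; injective⇒≤; combine-injectiveˡ; combine-injectiveʳ)
import Data.Fin.Properties as Finₚ
open import Data.List using (List; []; _∷_; length; lookup)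
open import Data.List.Membership.Propositional using (_∈_; _∉_; find; lose)
open import Data.List.Membership.Propositional.Properties using (∈-lookup)
import Data.List.Membership.DecPropositional as DecMembership
open import Data.List.Relation.Binary.Subset.Propositional using (_⊆_)
open import Data.List.Relation.Unary.All as All using (All; []; _∷_)
open import Data.List.Relation.Unary.All.Properties using (¬Any⇒All¬)
open import Data.List.Relation.Unary.Any as Any using (Any; here; there; any?)
open import Data.List.Relation.Unary.Any.Properties using (lookup-index)
open import Data.List.Relation.Unary.Unique.Propositional using (Unique; []; _∷_; tail)
open import Data.Nat using (ℕ; zero; suc; _≤_; _*_; s≤s; z≤n)
open import Data.Nat.Properties using (m≤n⇒m≤1+n)
open import Data.Product using (Σ; ∃; ∃₂; _×_; _,_; proj₁; proj₂)
open import Data.Product.Properties using (≡-dec)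
open import Data.Sum using (_⊎_; inj₁; inj₂)
open import Function.Bundles using (_⇔_; mk⇔)
open import Relation.Binary.Definitions using (DecidableEquality)
open import Relation.Binary.PropositionalEquality using (_≡_; _≢_; refl; sym; cong; subst)
open import Relation.Nullary using (¬_; Dec; yes; no; contradiction)
open import Relation.Nullary.Decidable using (_×-dec_; _⊎-dec_; map′; ¬?)
open import Relation.Unary using (Decidable)

open import Defs

infix 4 _≺[_]_ _≼[_]_

data _≺[_]_ {A : Set} : A → List A → A → Set where
  first : ∀ {u v xs} → v ∈ xs → u ≺[ u ∷ xs ] v
  later : ∀ {u v x xs} → u ≺[ xs ] v → u ≺[ x ∷ xs ] v

_≼[_]_ : {A : Set} → A → List A → A → Set
u ≼[ xs ] v = u ≡ v ⊎ u ≺[ xs ] v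

module _ {A : Set} where

  ≺⇒∈ˡ : ∀ {xs} {u v : A} → u ≺[ xs ] v → u ∈ xs
  ≺⇒∈ˡ (first _) = here refl
  ≺⇒∈ˡ (later p) = there (≺⇒∈ˡ p)

  ≺⇒∈ʳ : ∀ {xs} {u v : A} → u ≺[ xs ] v → v ∈ xs
  ≺⇒∈ʳ (first v∈) = there v∈
  ≺⇒∈ʳ (later p) = there (≺⇒∈ʳ p)

  ≺-tri : ∀ {xs} {u v : A} → u ∈ xs → v ∈ xs → u ≡ v ⊎ u ≺[ xs ] v ⊎ v ≺[ xs ] u
  ≺-tri (here refl) (here refl) = inj₁ refl
  ≺-tri (here refl) (there v∈) = inj₂ (inj₁ (first v∈))
  ≺-tri (there u∈) (here refl) = inj₂ (inj₂ (first u∈))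
  ≺-tri (there u∈) (there v∈) with ≺-tri u∈ v∈
  ... | inj₁ u≡v = inj₁ u≡v
  ... | inj₂ (inj₁ u≺v) = inj₂ (inj₁ (later u≺v))
  ... | inj₂ (inj₂ v≺u) = inj₂ (inj₂ (later v≺u))

  head-≢ : ∀ {x : A} {xs u} → Unique (x ∷ xs) → u ∈ xs → x ≢ u
  head-≢ (x≢ ∷ _) = All.lookup x≢

  ¬≺-head : ∀ {x : A} {xs v} → Unique (x ∷ xs) → ¬ v ≺[ x ∷ xs ] x
  ¬≺-head xs! (first x∈) = head-≢ xs! x∈ refl
  ¬≺-head xs! (later v≺x) = head-≢ xs! (≺⇒∈ʳ v≺x) refl

  ≺-irrefl : ∀ {xs} {u : A} → Unique xs → ¬ u ≺[ xs ] u
  ≺-irrefl xs! (first u∈) = head-≢ xs! u∈ refl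
  ≺-irrefl (_ ∷ xs!) (later u≺u) = ≺-irrefl xs! u≺u

  ≺-trans : ∀ {xs} {u v w : A} → Unique xs → u ≺[ xs ] v → v ≺[ xs ] w → u ≺[ xs ] w
  ≺-trans xs! (first v∈) (first _) = ⊥-elim (head-≢ xs! v∈ refl)
  ≺-trans _ (first _) (later v≺w) = first (≺⇒∈ʳ v≺w)
  ≺-trans xs! (later u≺v) (first _) = ⊥-elim (head-≢ xs! (≺⇒∈ʳ u≺v) refl)
  ≺-trans (_ ∷ xs!) (later u≺v) (later v≺w) = later (≺-trans xs! u≺v v≺w)

  ≺-tail : ∀ {x : A} {xs u v} → Unique (x ∷ xs) → u ∈ xs → u ≺[ x ∷ xs ] v → u ≺[ xs ] v
  ≺-tail xs! u∈ (first _) = ⊥-elim (head-≢ xs! u∈ refl)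
  ≺-tail _ _ (later u≺v) = u≺v

  ≼-≺-trans : ∀ {xs} {u v w : A} → Unique xs → u ≼[ xs ] v → v ≺[ xs ] w → u ≺[ xs ] w
  ≼-≺-trans _ (inj₁ refl) v≺w = v≺w
  ≼-≺-trans xs! (inj₂ u≺v) v≺w = ≺-trans xs! u≺v v≺w

  ≺-≼-trans : ∀ {xs} {u v w : A} → Unique xs → u ≺[ xs ] v → v ≼[ xs ] w → u ≺[ xs ] w
  ≺-≼-trans _ u≺v (inj₁ refl) = u≺v
  ≺-≼-trans xs! u≺v (inj₂ v≺w) = ≺-trans xs! u≺v v≺w

  ≼-trans : ∀ {xs} {u v w : A} → Unique xs → u ≼[ xs ] v → v ≼[ xs ] w → u ≼[ xs ] w
  ≼-trans _ (inj₁ refl) v≼w = v≼w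
  ≼-trans xs! (inj₂ u≺v) v≼w = inj₂ (≺-≼-trans xs! u≺v v≼w)

  ≺⇒≱ : ∀ {xs} {u v : A} → Unique xs → u ≺[ xs ] v → ¬ v ≼[ xs ] u
  ≺⇒≱ xs! u≺v v≼u = ≺-irrefl xs! (≺-≼-trans xs! u≺v v≼u)

  ≼-total : ∀ {xs} {u v : A} → u ∈ xs → v ∈ xs → u ≼[ xs ] v ⊎ v ≺[ xs ] u
  ≼-total u∈ v∈ with ≺-tri u∈ v∈
  ... | inj₁ u≡v = inj₁ (inj₁ u≡v)
  ... | inj₂ (inj₁ u≺v) = inj₁ (inj₂ u≺v)
  ... | inj₂ (inj₂ v≺u) = inj₂ v≺u

  ≺? : DecidableEquality A → ∀ xs (u v : A) → Dec (u ≺[ xs ] v)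
  ≺? _≟_ [] u v = no λ ()
  ≺? _≟_ (x ∷ xs) u v with u ≟ x | ≺? _≟_ xs u v | any? (v ≟_) xs
  ... | _ | yes u≺v | _ = yes (later u≺v)
  ... | yes refl | no _ | yes v∈ = yes (first v∈)
  ... | yes refl | no u⊀v | no v∉ = no λ { (first v∈) → v∉ v∈ ; (later u≺v) → u⊀v u≺v }
  ... | no u≢x | no u⊀v | _ = no λ { (first _) → u≢x refl ; (later u≺v) → u⊀v u≺v }

  ≼? : DecidableEquality A → ∀ xs (u v : A) → Dec (u ≼[ xs ] v)
  ≼? _≟_ xs u v = (u ≟ v) ⊎-dec ≺? _≟_ xs u v


  ≼-later : ∀ {x : A} {xs u v} → u ≼[ xs ] v → u ≼[ x ∷ xs ] v
  ≼-later (inj₁ u≡v) = inj₁ u≡v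
  ≼-later (inj₂ u≺v) = inj₂ (later u≺v)

  ≼⇒∈ˡ : ∀ {xs} {u v : A} → v ∈ xs → u ≼[ xs ] v → u ∈ xs
  ≼⇒∈ˡ v∈ (inj₁ refl) = v∈
  ≼⇒∈ˡ _ (inj₂ u≺v) = ≺⇒∈ˡ u≺v

  head-≼-all : ∀ {x : A} {xs} → All (x ≼[ x ∷ xs ]_) (x ∷ xs)
  head-≼-all = inj₁ refl ∷ All.tabulate (λ x∈ → inj₂ (first x∈))

  ≼⇒∈ʳ : ∀ {xs} {u v : A} → u ∈ xs → u ≼[ xs ] v → v ∈ xs
  ≼⇒∈ʳ u∈ (inj₁ refl) = u∈
  ≼⇒∈ʳ _ (inj₂ u≺v) = ≺⇒∈ʳ u≺v

  earliest : ∀ {Q : A → Set} {xs} → Decidable Q → Unique xs → Any Q xs →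
             ∃ λ u → u ∈ xs × Q u × (∀ {v} → v ≺[ xs ] u → ¬ Q v)
  earliest {xs = x ∷ _} Q? xs! ∃Q with Q? x | ∃Q
  ... | yes Qx | _ = x , here refl , Qx , λ v≺x _ → ¬≺-head xs! v≺x
  ... | no ¬Qx | here Qx = contradiction Qx ¬Qx
  ... | no ¬Qx | there ∃Q′ with earliest Q? (tail xs!) ∃Q′
  ...   | u , u∈ , Qu , min = u , there u∈ , Qu , λ { (first _) → ¬Qx ; (later v≺u) → min v≺u }

  latest : ∀ {Q : A → Set} {xs y} → Decidable Q → Unique xs → y ∈ xs → Q y →
           ∃ λ w → Q w × y ≼[ xs ] w × (∀ {v} → w ≺[ xs ] v → ¬ Q v)
  latest {xs = x ∷ xs} Q? xs! (there y∈) Qy with latest Q? (tail xs!) y∈ Qy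
  ... | w , Qw , y≼w , max =
    w , Qw , ≼-later y≼w , λ w≺v → max (≺-tail xs! (≼⇒∈ʳ y∈ y≼w) w≺v)
  latest {xs = x ∷ xs} Q? xs! (here refl) Qx with any? Q? xs
  ... | no ¬∃Q = x , Qx , inj₁ refl , λ x≺v Qv → ¬∃Q (lose (after-head x≺v) Qv)
    where
    after-head : ∀ {v} → x ≺[ x ∷ xs ] v → v ∈ xs
    after-head (first v∈) = v∈
    after-head (later x≺v) = ⊥-elim (head-≢ xs! (≺⇒∈ˡ x≺v) refl)
  ... | yes ∃Q with find ∃Q
  ...   | z , z∈ , Qz with latest Q? (tail xs!) z∈ Qz
  ...     | w , Qw , z≼w , max =
    w , Qw , inj₂ (first (≼⇒∈ʳ z∈ z≼w)) , λ w≺v → max (≺-tail xs! (≼⇒∈ʳ z∈ z≼w) w≺v)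

  lookup-injective : ∀ {xs : List A} → Unique xs → ∀ {i j} → lookup xs i ≡ lookup xs j → i ≡ j
  lookup-injective {_ ∷ _} _ {Fin.zero} {Fin.zero} _ = refl
  lookup-injective {_ ∷ _} xs! {Fin.zero} {Fin.suc j} eq = ⊥-elim (head-≢ xs! (∈-lookup j) eq)
  lookup-injective {_ ∷ _} xs! {Fin.suc i} {Fin.zero} eq = ⊥-elim (head-≢ xs! (∈-lookup i) (sym eq))
  lookup-injective {_ ∷ _} (_ ∷ xs!) {Fin.suc i} {Fin.suc j} eq = cong Fin.suc (lookup-injective xs! eq)

  length-≤-by-key : ∀ {P : A → Set} {m xs} (key : ∀ {x} → P x → Fin m) →
                    (∀ {x y} (p : P x) (q : P y) → key p ≡ key q → x ≡ y) →
                    Unique xs → All P xs → length xs ≤ m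
  length-≤-by-key {xs = xs} key key-inj xs! Pxs =
    injective⇒≤ {f = λ i → key (All.lookup Pxs (∈-lookup i))}
      λ eq → lookup-injective xs! (key-inj _ _ eq)

module _ {n : ℕ} where

  Before⇒≺ : ∀ {xs : List (Fin n)} {u v} → Before xs u v → u ≺[ xs ] v
  Before⇒≺ {_ ∷ _} (Fin.zero , Fin.suc j , _ , refl , refl) = first (∈-lookup j)
  Before⇒≺ {_ ∷ _} (Fin.suc i , Fin.suc j , s≤s i<j , refl , refl) =
    later (Before⇒≺ (i , j , i<j , refl , refl))

  ≺⇒Before : ∀ {xs : List (Fin n)} {u v} → u ≺[ xs ] v → Before xs u v
  ≺⇒Before (first v∈) = Fin.zero , Fin.suc (Any.index v∈) , s≤s z≤n , refl , sym (lookup-index v∈)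
  ≺⇒Before (later u≺v) with ≺⇒Before u≺v
  ... | i , j , i<j , u≡ , v≡ = Fin.suc i , Fin.suc j , s≤s i<j , u≡ , v≡

  Unique⇒length≤ : ∀ {xs : List (Fin n)} → Unique xs → length xs ≤ n
  Unique⇒length≤ xs! = injective⇒≤ (lookup-injective xs!)

  edge⇒≺ : ∀ {vs : List (Fin n)} {x y} → (x , y) ∈ edgesOf vs → x ≺[ vs ] y
  edge⇒≺ {_ ∷ _ ∷ _} (here refl) = first (here refl)
  edge⇒≺ {_ ∷ _ ∷ _} (there e∈) = later (edge⇒≺ e∈)

  edge-next : ∀ {vs : List (Fin n)} {x y w} → Unique vs →
              (x , y) ∈ edgesOf vs → x ≺[ vs ] w → y ≼[ vs ] w
  edge-next {_ ∷ _ ∷ _} _ (here refl) (first (here w≡)) = inj₁ (sym w≡)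
  edge-next {_ ∷ _ ∷ _} _ (here refl) (first (there w∈)) = inj₂ (later (first w∈))
  edge-next {_ ∷ _ ∷ _} vs! (here refl) (later x≺w) = ⊥-elim (head-≢ vs! (≺⇒∈ˡ x≺w) refl)
  edge-next {_ ∷ _ ∷ _} vs! (there e∈) (first _) = ⊥-elim (head-≢ vs! (≺⇒∈ˡ (edge⇒≺ e∈)) refl)
  edge-next {_ ∷ _ ∷ _} (_ ∷ vs!) (there e∈) (later x≺w) = ≼-later (edge-next vs! e∈ x≺w)

  edge-functional : ∀ {vs : List (Fin n)} {x y y′} → Unique vs →
                    (x , y) ∈ edgesOf vs → (x , y′) ∈ edgesOf vs → y ≡ y′
  edge-functional vs! e∈ e′∈ with edge-next vs! e∈ (edge⇒≺ e′∈)
  ... | inj₁ y≡y′ = y≡y′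
  ... | inj₂ y≺y′ with edge-next vs! e′∈ (edge⇒≺ e∈)
  ...   | inj₁ y′≡y = sym y′≡y
  ...   | inj₂ y′≺y = ⊥-elim (≺-irrefl vs! (≺-trans vs! y≺y′ y′≺y))

module _ {n : ℕ} {R : EdgeSet n} where

  open DecMembership (_≟_ {n}) using (_∈?_)

  edgesOf-step : ∀ {u w v vs} → PathIn R w v vs → edgesOf (u ∷ vs) ≡ (u , w) ∷ edgesOf vs
  edgesOf-step (single _) = refl
  edgesOf-step (step _ _) = refl

  pathIn-edge : ∀ {u v vs e} → PathIn R u v vs → e ∈ edgesOf vs → R e
  pathIn-edge (step r p) e∈ with subst (_ ∈_) (edgesOf-step p) e∈
  ... | here refl = r
  ... | there e∈′ = pathIn-edge p e∈′

  pathIn-retype : ∀ {R′ : EdgeSet n} {u v vs} → (∀ {e} → e ∈ edgesOf vs → R′ e) →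
                  PathIn R u v vs → PathIn R′ u v vs
  pathIn-retype f (single v) = single v
  pathIn-retype f (step r p) =
    step (f (subst (_ ∈_) (sym (edgesOf-step p)) (here refl)))
         (pathIn-retype (λ e∈ → f (subst (_ ∈_) (sym (edgesOf-step p)) (there e∈))) p)

  pathIn-last : ∀ {u v vs} → PathIn R u v vs → v ∈ vs
  pathIn-last (single _) = here refl
  pathIn-last (step _ p) = there (pathIn-last p)

  ¬last-≺ : ∀ {u v vs x} → PathIn R u v vs → Unique vs → ¬ v ≺[ vs ] x
  ¬last-≺ (single _) _ (later ())
  ¬last-≺ (step _ p) vs! (first _) = head-≢ vs! (pathIn-last p) refl
  ¬last-≺ (step _ p) (_ ∷ vs!) (later v≺x) = ¬last-≺ p vs! v≺x

  pathIn-head-≼ : ∀ {u v vs w} → PathIn R u v vs → w ∈ vs → u ≼[ vs ] w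
  pathIn-head-≼ (single _) (here refl) = inj₁ refl
  pathIn-head-≼ (step _ _) (here refl) = inj₁ refl
  pathIn-head-≼ (step _ _) (there w∈) = inj₂ (first w∈)

  pathIn-≼-last : ∀ {u v vs w} → PathIn R u v vs → Unique vs → w ∈ vs → w ≼[ vs ] v
  pathIn-≼-last p vs! w∈ with ≼-total w∈ (pathIn-last p)
  ... | inj₁ w≼v = w≼v
  ... | inj₂ v≺w = ⊥-elim (¬last-≺ p vs! v≺w)

  _++ᵖ_ : ∀ {u w v xs ys} → PathIn R u w xs → PathIn R w v ys → ∃ λ zs → PathIn R u v zs
  single _ ++ᵖ q = _ , q
  step r p ++ᵖ q = _ , step r (proj₂ (p ++ᵖ q))

  prefix : ∀ {u v w vs} → PathIn R u v vs → w ∈ vs →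
           ∃ λ zs → PathIn R u w zs × edgesOf zs ⊆ edgesOf vs × All (_≼[ vs ] w) zs
  prefix (single _) (here refl) = _ , single _ , (λ ()) , inj₁ refl ∷ []
  prefix (step _ _) (here refl) = _ , single _ , (λ ()) , inj₁ refl ∷ []
  prefix (step r p) (there w∈) with prefix p w∈
  ... | zs , q , sub , ≼w = _ , step r q , sub′ , inj₂ (first w∈) ∷ All.map ≼-later ≼w
    where
    sub′ : edgesOf (_ ∷ zs) ⊆ edgesOf (_ ∷ _)
    sub′ e∈ with subst (_ ∈_) (edgesOf-step q) e∈
    ... | here refl = subst (_ ∈_) (sym (edgesOf-step p)) (here refl)
    ... | there e∈′ = subst (_ ∈_) (sym (edgesOf-step p)) (there (sub e∈′))

  suffix : ∀ {u v w vs} → PathIn R u v vs → w ∈ vs →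
           ∃ λ zs → PathIn R w v zs × edgesOf zs ⊆ edgesOf vs × All (w ≼[ vs ]_) zs ×
                    (Unique vs → Unique zs)
  suffix p@(single _) (here refl) = _ , p , (λ e∈ → e∈) , head-≼-all , λ vs! → vs!
  suffix p@(step _ _) (here refl) = _ , p , (λ e∈ → e∈) , head-≼-all , λ vs! → vs!
  suffix (single _) (there ())
  suffix (step r p) (there w∈) with suffix p w∈
  ... | zs , q , sub , w≼ , zs! =
    zs , q , (λ e∈ → subst (_ ∈_) (sym (edgesOf-step p)) (there (sub e∈))) ,
    All.map ≼-later w≼ , λ vs! → zs! (tail vs!)

  shortcut : ∀ {u v vs} → PathIn R u v vs → Reach R u v
  shortcut (single v) = _ , single v , [] ∷ []
  shortcut (step {u = u} r p) with shortcut p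
  ... | zs , q , zs! with u ∈? zs
  ...   | yes u∈ = let ys , q′ , _ , _ , ys! = suffix q u∈ in ys , q′ , ys! zs!
  ...   | no u∉ = u ∷ zs , step r q , ¬Any⇒All¬ zs u∉ ∷ zs!

  reach-via : ∀ {u w v xs ys} → PathIn R u w xs → PathIn R w v ys → Reach R u v
  reach-via p q = shortcut (proj₂ (p ++ᵖ q))

  ReachWithin : ℕ → Fin n → Fin n → Set
  ReachWithin zero u v = u ≡ v
  ReachWithin (suc k) u v = u ≡ v ⊎ ∃ λ w → R (u , w) × ReachWithin k w v

  reachWithin? : Decidable R → ∀ k u v → Dec (ReachWithin k u v)
  reachWithin? R? zero u v = u ≟ v
  reachWithin? R? (suc k) u v =
    (u ≟ v) ⊎-dec Finₚ.any? (λ w → R? (u , w) ×-dec reachWithin? R? k w v)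

  reachWithin⇒pathIn : ∀ k {u v} → ReachWithin k u v → ∃ (PathIn R u v)
  reachWithin⇒pathIn zero refl = _ , single _
  reachWithin⇒pathIn (suc k) (inj₁ refl) = _ , single _
  reachWithin⇒pathIn (suc k) (inj₂ (w , r , within)) = _ , step r (proj₂ (reachWithin⇒pathIn k within))

  pathIn⇒reachWithin : ∀ k {u v vs} → PathIn R u v vs → length vs ≤ suc k → ReachWithin k u v
  pathIn⇒reachWithin zero (single _) _ = refl
  pathIn⇒reachWithin zero (step _ (single _)) (s≤s ())
  pathIn⇒reachWithin zero (step _ (step _ _)) (s≤s ())
  pathIn⇒reachWithin (suc k) (single _) _ = inj₁ refl
  pathIn⇒reachWithin (suc k) (step r p) (s≤s len) = inj₂ (_ , r , pathIn⇒reachWithin k p len)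

  -- A path visits at most n vertices, so walks of at most n steps suffice.
  reach? : Decidable R → ∀ u v → Dec (Reach R u v)
  reach? R? u v = map′
    (λ within → shortcut (proj₂ (reachWithin⇒pathIn n within)))
    (λ (vs , p , vs!) → pathIn⇒reachWithin n p (m≤n⇒m≤1+n (Unique⇒length≤ vs!)))
    (reachWithin? R? n u v)

module OuterStrandFacts {n : ℕ} (E : List (Edge n)) (s t : Fin n) (P : Fin 2 → List (Fin n))
                        (strands : Strands.OuterStrands E s t P) where
  open Strands E s t P

  strand-path : ∀ k → PathIn (G E s t) s t (P k)
  strand-path k = proj₁ (proj₁ strands k)

  strand-unique : ∀ k → Unique (P k)
  strand-unique k = proj₂ (proj₁ strands k)

  OffStrands : EdgeSet n
  OffStrands e = e ∈ E × (∀ k → e ∉ edgesOf (P k))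

  offStrands? : Decidable OffStrands
  offStrands? e = (e ∈? E) ×-dec Finₚ.all? (λ k → ¬? (e ∈? edgesOf (P k)))
    where open DecMembership (≡-dec _≟_ _≟_) using (_∈?_)

  pathIn-offStrands : ∀ {u v q} → IsPath (G E s t) u v q → EdgeDisjointFromStrands q → PathIn OffStrands u v q
  pathIn-offStrands (p , _) disjoint = pathIn-retype (λ e∈ → pathIn-edge p e∈ , disjoint _ e∈) p

  reach⇒disjReach : ∀ {u v} → Reach OffStrands u v → DisjReach u v
  reach⇒disjReach (q , p , q!) =
    q , (pathIn-retype (λ e∈ → proj₁ (pathIn-edge p e∈)) p , q!) , λ e e∈ → proj₂ (pathIn-edge p e∈)

  disjReach? : ∀ u v → Dec (DisjReach u v)
  disjReach? u v = map′ reach⇒disjReach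
    (λ (q , path , disjoint) → q , pathIn-offStrands path disjoint , proj₂ path)
    (reach? offStrands? u v)

  disjReach-through : ∀ {u v q u′ v′ q′ x} → PathIn OffStrands u v q → PathIn OffStrands u′ v′ q′ →
                      x ∈ q → x ∈ q′ → DisjReach u v′
  disjReach-through p p′ x∈ x∈′ =
    let _ , to-x , _ = prefix p x∈
        _ , from-x , _ = suffix p′ x∈′
    in reach⇒disjReach (reach-via to-x from-x)

  couplingPoint-≼ : ∀ {i v u x} → IsCouplingPoint i v u → x ∈ P i → DisjReach x v → u ≼[ P i ] x
  couplingPoint-≼ (u∈ , _ , min) x∈ reach with ≼-total u∈ x∈
  ... | inj₁ u≼x = u≼x
  ... | inj₂ x≺u = ⊥-elim (min _ x∈ reach (≺⇒Before x≺u))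

  couplingPoint-unique : ∀ {i v u u′} → IsCouplingPoint i v u → IsCouplingPoint i v u′ → u ≡ u′
  couplingPoint-unique {i} c@(_ , reach , _) c′@(u′∈ , reach′ , _) with couplingPoint-≼ c u′∈ reach′
  ... | inj₁ u≡u′ = u≡u′
  ... | inj₂ u≺u′ = ⊥-elim (≺⇒≱ (strand-unique i) u≺u′ (couplingPoint-≼ c′ (proj₁ c) reach))

  couplingPoint? : ∀ i v → (∃ (IsCouplingPoint i v)) ⊎ (∀ {x} → x ∈ P i → ¬ DisjReach x v)
  couplingPoint? i v with any? (λ x → disjReach? x v) (P i)
  ... | no none = inj₂ λ x∈ reach → none (lose x∈ reach)
  ... | yes some with earliest (λ x → disjReach? x v) (strand-unique i) some
  ...   | u , u∈ , reach , min = inj₁ (u , u∈ , reach , λ x _ reachₓ x<u → min (Before⇒≺ x<u) reachₓ)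

  CoupledBelow : Fin 2 → Fin n → Fin n → Set
  CoupledBelow i u v = ∃ λ uᵥ → IsCouplingPoint i v uᵥ × uᵥ ≼[ P i ] u

  coupledBelow? : ∀ i u → Decidable (CoupledBelow i u)
  coupledBelow? i u v with couplingPoint? i v
  ... | inj₂ none = no λ (_ , c , _) → none (proj₁ c) (proj₁ (proj₂ c))
  ... | inj₁ (uᵥ , c) with ≼? _≟_ (P i) uᵥ u
  ...   | yes uᵥ≼u = yes (uᵥ , c , uᵥ≼u)
  ...   | no uᵥ⋠u = no λ (_ , c′ , u′≼u) →
    uᵥ⋠u (subst (_≼[ P i ] u) (sym (couplingPoint-unique c c′)) u′≼u)

module CouplingPathFacts {n : ℕ} (E : List (Edge n)) (s t : Fin n) (P : Fin 2 → List (Fin n))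
                         (strands : Strands.OuterStrands E s t P)
                         (Q : Fin 2 → Fin n → List (Fin n)) (paths : Strands.CouplingPaths E s t P Q) where
  open Strands E s t P
  open OuterStrandFacts E s t P strands

  onStrands : ∀ j {v} → v ∈ P j → OnStrands v
  onStrands Fin.zero v∈ = inj₁ v∈
  onStrands (Fin.suc Fin.zero) v∈ = inj₂ v∈

  couplingPath : ∀ {i j v u} → v ∈ P j → IsCouplingPoint i v u → PathIn OffStrands u v (Q i v)
  couplingPath {j = j} v∈ c =
    let path , disjoint = paths _ _ _ (onStrands j v∈) c in pathIn-offStrands path disjoint

  couplingPath-unique : ∀ {i j v u} → v ∈ P j → IsCouplingPoint i v u → Unique (Q i v)
  couplingPath-unique {j = j} v∈ c = proj₂ (proj₁ (paths _ _ _ (onStrands j v∈) c))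

  Selected : Fin 2 → Fin 2 → Fin n → Fin n → Set
  Selected i j v u = ∀ v′ u′ → Before (P j) v v′ → IsCouplingPoint i v′ u′ → Before (P i) u u′

  selectedPaths-ordered : ∀ {i j v u v′ u′ x} → v ≺[ P j ] v′ →
    v ∈ P j → IsCouplingPoint i v u → Selected i j v u → v′ ∈ P j → IsCouplingPoint i v′ u′ →
    x ∈ Q i v → x ∈ Q i v′ → ⊥
  selectedPaths-ordered {i} v≺v′ v∈ c sel v′∈ c′ x∈ x∈′ =
    ≺⇒≱ (strand-unique i) (Before⇒≺ (sel _ _ (≺⇒Before v≺v′) c′))
      (couplingPoint-≼ c′ (proj₁ c) (disjReach-through (couplingPath v∈ c) (couplingPath v′∈ c′) x∈ x∈′))

  selectedPaths-disjoint : ∀ {i j v u v′ u′ x} →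
    v ∈ P j → IsCouplingPoint i v u → Selected i j v u →
    v′ ∈ P j → IsCouplingPoint i v′ u′ → Selected i j v′ u′ →
    x ∈ Q i v → x ∈ Q i v′ → v ≡ v′
  selectedPaths-disjoint v∈ c sel v′∈ c′ sel′ x∈ x∈′ with ≺-tri v∈ v′∈
  ... | inj₁ v≡v′ = v≡v′
  ... | inj₂ (inj₁ v≺v′) = ⊥-elim (selectedPaths-ordered v≺v′ v∈ c sel v′∈ c′ x∈ x∈′)
  ... | inj₂ (inj₂ v′≺v) = ⊥-elim (selectedPaths-ordered v′≺v v′∈ c′ sel′ v∈ c x∈′ x∈)

  selected-after : ∀ {i j y u} → y ∈ P j → IsCouplingPoint i y u →
    ∃₂ λ w uw → y ≼[ P j ] w × IsCouplingPoint i w uw × uw ≼[ P i ] u × Selected i j w uw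
  selected-after {i} {j} {u = u} y∈ c with latest (coupledBelow? i u) (strand-unique j) y∈ (u , c , inj₁ refl)
  ... | w , (uw , cw , uw≼u) , y≼w , max = w , uw , y≼w , cw , uw≼u , selected
    where
    selected : Selected i j w uw
    selected _ _ w<v′ c′ with ≼-total (proj₁ c′) (proj₁ c)
    ... | inj₁ u′≼u = ⊥-elim (max (Before⇒≺ w<v′) (_ , c′ , u′≼u))
    ... | inj₂ u≺u′ = ≺⇒Before (≼-≺-trans (strand-unique i) uw≼u u≺u′)

  HEdgeOfClass : Fin 3 → Fin 2 → EdgeSet n
  HEdgeOfClass Fin.zero k e = e ∈ edgesOf (P k)
  HEdgeOfClass (Fin.suc i) j e = Σ (Fin n) λ v → Σ (Fin n) λ u →
    v ∈ P j × IsCouplingPoint i v u × e ∈ edgesOf (Q i v) × Selected i j v u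

  H-class : ∀ {e} → H Q e → Σ (Fin 3) λ c → Σ (Fin 2) λ k → HEdgeOfClass c k e
  H-class (inj₁ (k , e∈)) = Fin.zero , k , e∈
  H-class (inj₂ (i , j , inQ)) = Fin.suc i , j , inQ

  HEdgeOfClass-functional : ∀ c k {x y y′} →
                            HEdgeOfClass c k (x , y) → HEdgeOfClass c k (x , y′) → y ≡ y′
  HEdgeOfClass-functional Fin.zero k e∈ e′∈ = edge-functional (strand-unique k) e∈ e′∈
  HEdgeOfClass-functional (Fin.suc i) j (v , u , v∈ , c , e∈ , sel) (v′ , u′ , v′∈ , c′ , e′∈ , sel′)
    with selectedPaths-disjoint v∈ c sel v′∈ c′ sel′ (≺⇒∈ˡ (edge⇒≺ e∈)) (≺⇒∈ˡ (edge⇒≺ e′∈))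
  ... | refl = edge-functional (couplingPath-unique v∈ c) e∈ e′∈

  classKey-injective : ∀ {c k c′ k′ x y x′ y′} →
    HEdgeOfClass c k (x , y) → HEdgeOfClass c′ k′ (x′ , y′) →
    Fin.combine (Fin.combine c k) x ≡ Fin.combine (Fin.combine c′ k′) x′ → (x , y) ≡ (x′ , y′)
  classKey-injective {c} {k} {c′} {k′} {x} {x′ = x′} e∈ e′∈ same
    with combine-injectiveˡ (Fin.combine c k) x (Fin.combine c′ k′) x′ same
       | combine-injectiveʳ (Fin.combine c k) x (Fin.combine c′ k′) x′ same
  ... | sameClass | refl
    with combine-injectiveˡ c k c′ k′ sameClass | combine-injectiveʳ c k c′ k′ sameClass
  ... | refl | refl = cong (x ,_) (HEdgeOfClass-functional c k e∈ e′∈)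

  H-key : ∀ {e} → H Q e → Fin (6 * n)
  H-key {x , _} h = Fin.combine (Fin.combine (proj₁ (H-class h)) (proj₁ (proj₂ (H-class h)))) x

  H-key-injective : ∀ {e e′} (h : H Q e) (h′ : H Q e′) → H-key h ≡ H-key h′ → e ≡ e′
  H-key-injective h h′ = classKey-injective (proj₂ (proj₂ (H-class h))) (proj₂ (proj₂ (H-class h′)))

  H-size : ∀ {L} → Unique L → All (H Q) L → length L ≤ 6 * n
  H-size = length-≤-by-key H-key H-key-injective

module _ {n : ℕ} (A B : Fin n → Set) where

  Outside : Fin n → Set
  Outside w = ¬ A w × ¬ B w

  CrossingEdge : EdgeSet n
  CrossingEdge (p , q) = Outside p ⊎ Outside q ⊎ (A p × ¬ B p × B q × ¬ A q)

  Crossing : EdgeSet n → Set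
  Crossing R = (∃ λ w → A w × B w) ⊎
               (∃₂ λ x y → A x × B y × ∃ (PathIn (λ e → R e × CrossingEdge e) x y))

module _ {n : ℕ} {R : EdgeSet n} {A B : Fin n → Set} (A? : Decidable A) (B? : Decidable B) where

  private
    -- x is the last A-vertex met so far and seg leads from x to the current vertex c
    -- through Outside vertices only.
    crossing-from : ∀ {x c v seg vs} → A x → ¬ B x → PathIn (λ e → R e × CrossingEdge A B e) x c seg →
                    c ≡ x ⊎ Outside A B c → PathIn R c v vs → B v → Crossing A B R
    crossing-from _ ¬Bx _ (inj₁ refl) (single _) Bv = ⊥-elim (¬Bx Bv)
    crossing-from _ _ _ (inj₂ (_ , ¬Bv)) (single _) Bv = ⊥-elim (¬Bv Bv)
    crossing-from {x} Ax ¬Bx seg c≈x (step {w = w} r p) Bv with A? w | B? w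
    ... | yes Aw | yes Bw = inj₁ (w , Aw , Bw)
    ... | yes Aw | no ¬Bw = crossing-from Aw ¬Bw (single w) (inj₁ refl) p Bv
    ... | no ¬Aw | no ¬Bw =
      crossing-from Ax ¬Bx (proj₂ (seg ++ᵖ step (r , inj₂ (inj₁ (¬Aw , ¬Bw))) (single w)))
                    (inj₂ (¬Aw , ¬Bw)) p Bv
    ... | no ¬Aw | yes Bw = inj₂ (x , w , Ax , Bw , seg ++ᵖ step (r , lastEdge c≈x) (single w))
      where
      lastEdge : _ ≡ x ⊎ Outside A B _ → CrossingEdge A B (_ , w)
      lastEdge (inj₁ refl) = inj₂ (inj₂ (Ax , ¬Bx , Bw , ¬Aw))
      lastEdge (inj₂ outside) = inj₁ outside

  crossing : ∀ {u v vs} → PathIn R u v vs → A u → B v → Crossing A B R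
  crossing {u} p Au Bv with B? u
  ... | yes Bu = inj₁ (u , Au , Bu)
  ... | no ¬Bu = crossing-from Au ¬Bu (single u) (inj₁ refl) p Bv

module TwoFailures {n : ℕ} (E : List (Edge n)) (s t : Fin n) (P : Fin 2 → List (Fin n))
                   (strands : Strands.OuterStrands E s t P)
                   (Q : Fin 2 → Fin n → List (Fin n)) (paths : Strands.CouplingPaths E s t P Q)
                   (F : List (Edge n)) (failedEdge : Fin 2 → Edge n)
                   (failed-on-strand : ∀ k → failedEdge k ∈ edgesOf (P k))
                   (failed : ∀ k → failedEdge k ∈ F)
                   (only-failed : ∀ {e} → e ∈ F → ∃ λ k → e ≡ failedEdge k)
                   (failed-exclusive : ∀ {k l} → failedEdge k ∈ edgesOf (P l) → k ≡ l) where
  open Strands E s t P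
  open OuterStrandFacts E s t P strands
  open CouplingPathFacts E s t P strands Q paths

  HF GF : EdgeSet n
  HF = H Q ∖ F
  GF = G E s t ∖ F

  a b : Fin 2 → Fin n
  a k = proj₁ (failedEdge k)
  b k = proj₂ (failedEdge k)

  strandEdge-survives : ∀ {k e} → e ∈ edgesOf (P k) → e ≢ failedEdge k → e ∉ F
  strandEdge-survives e∈ e≢ e∈F with only-failed e∈F
  ... | _ , refl with failed-exclusive e∈
  ...   | refl = e≢ refl

  offStrandEdge-survives : ∀ {e} → (∀ k → e ∉ edgesOf (P k)) → e ∉ F
  offStrandEdge-survives off e∈F with only-failed e∈F
  ... | k , refl = off k (failed-on-strand k)

  Upstream Downstream : Fin 2 → Fin n → Set
  Upstream k w = w ≼[ P k ] a k
  Downstream k w = b k ≼[ P k ] w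

  failure-≺ : ∀ k → a k ≺[ P k ] b k
  failure-≺ k = edge⇒≺ (failed-on-strand k)

  upstream-∈ : ∀ {k w} → Upstream k w → w ∈ P k
  upstream-∈ {k} = ≼⇒∈ˡ (≺⇒∈ˡ (failure-≺ k))

  downstream-∈ : ∀ {k w} → Downstream k w → w ∈ P k
  downstream-∈ {k} = ≼⇒∈ʳ (≺⇒∈ʳ (failure-≺ k))

  ¬upstream∧downstream : ∀ {k w} → Upstream k w → Downstream k w → ⊥
  ¬upstream∧downstream {k} w↑ w↓ =
    ≺⇒≱ (strand-unique k) (≼-≺-trans (strand-unique k) w↑ (failure-≺ k)) w↓

  upstream⊎downstream : ∀ {k w} → w ∈ P k → Upstream k w ⊎ Downstream k w
  upstream⊎downstream {k} w∈ with ≼-total w∈ (≺⇒∈ˡ (failure-≺ k))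
  ... | inj₁ w↑ = inj₁ w↑
  ... | inj₂ a≺w = inj₂ (edge-next (strand-unique k) (failed-on-strand k) a≺w)

  upstream-path : ∀ {k w} → Upstream k w → ∃ (PathIn HF s w)
  upstream-path {k} w↑ with prefix (strand-path k) (upstream-∈ w↑)
  ... | zs , p , sub , ≼w = zs , pathIn-retype survives p
    where
    survives : ∀ {e} → e ∈ edgesOf zs → HF e
    survives e∈ = inj₁ (k , sub e∈) , strandEdge-survives (sub e∈) λ { refl →
      ¬upstream∧downstream (≼-trans (strand-unique k) (All.lookup ≼w (≺⇒∈ʳ (edge⇒≺ e∈))) w↑) (inj₁ refl) }

  downstream-path : ∀ {k w} → Downstream k w → ∃ (PathIn HF w t)
  downstream-path {k} w↓ with suffix (strand-path k) (downstream-∈ w↓)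
  ... | zs , p , sub , w≼ , _ = zs , pathIn-retype survives p
    where
    survives : ∀ {e} → e ∈ edgesOf zs → HF e
    survives e∈ = inj₁ (k , sub e∈) , strandEdge-survives (sub e∈) λ { refl →
      ¬upstream∧downstream (inj₁ refl) (≼-trans (strand-unique k) w↓ (All.lookup w≼ (≺⇒∈ˡ (edge⇒≺ e∈)))) }

  SomeUpstream SomeDownstream : Fin n → Set
  SomeUpstream w = ∃ λ k → Upstream k w
  SomeDownstream w = ∃ λ k → Downstream k w

  someUpstream? : Decidable SomeUpstream
  someUpstream? w = Finₚ.any? λ k → ≼? _≟_ (P k) w (a k)

  someDownstream? : Decidable SomeDownstream
  someDownstream? w = Finₚ.any? λ k → ≼? _≟_ (P k) (b k) w

  outside-offStrand : ∀ {k w} → Outside SomeUpstream SomeDownstream w → w ∉ P k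
  outside-offStrand {k} (¬w↑ , ¬w↓) w∈ with upstream⊎downstream w∈
  ... | inj₁ w↑ = ¬w↑ (k , w↑)
  ... | inj₂ w↓ = ¬w↓ (k , w↓)

  crossingEdge-offStrands : ∀ {e} → GF e → CrossingEdge SomeUpstream SomeDownstream e →
                            ∀ k → e ∉ edgesOf (P k)
  crossingEdge-offStrands _ (inj₁ p-out) k e∈ = outside-offStrand p-out (≺⇒∈ˡ (edge⇒≺ e∈))
  crossingEdge-offStrands _ (inj₂ (inj₁ q-out)) k e∈ = outside-offStrand q-out (≺⇒∈ʳ (edge⇒≺ e∈))
  crossingEdge-offStrands (_ , e∉F) (inj₂ (inj₂ (_ , ¬p↓ , _ , ¬q↑))) k e∈
    with upstream⊎downstream (≺⇒∈ˡ (edge⇒≺ e∈))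
  ... | inj₂ p↓ = ¬p↓ (k , p↓)
  ... | inj₁ (inj₂ p≺a) = ¬q↑ (k , edge-next (strand-unique k) e∈ p≺a)
  ... | inj₁ (inj₁ refl) with edge-functional (strand-unique k) e∈ (failed-on-strand k)
  ...   | refl = e∉F (failed k)

  selected-path : ∀ {i j w u} → w ∈ P j → IsCouplingPoint i w u → Selected i j w u → PathIn HF u w (Q i w)
  selected-path {i} {j} w∈ c sel = pathIn-retype
    (λ e∈ → inj₂ (i , j , _ , _ , w∈ , c , e∈ , sel) ,
            offStrandEdge-survives (proj₂ (pathIn-edge (couplingPath w∈ c) e∈)))
    (couplingPath w∈ c)

  coupled : ∀ {i j x y} → Upstream i x → Downstream j y → DisjReach x y → Reach HF s t
  coupled {i} {j} {y = y} x↑ y↓ reach with couplingPoint? i y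
  ... | inj₂ none = ⊥-elim (none (upstream-∈ x↑) reach)
  ... | inj₁ (u , c) with selected-after (downstream-∈ y↓) c
  ...   | w , uw , y≼w , cw , uw≼u , sel =
    reach-via (proj₂ (proj₂ (upstream-path uw↑) ++ᵖ selected-path (downstream-∈ w↓) cw sel))
              (proj₂ (downstream-path w↓))
    where
    uw↑ : Upstream i uw
    uw↑ = ≼-trans (strand-unique i) uw≼u
            (≼-trans (strand-unique i) (couplingPoint-≼ c (upstream-∈ x↑) reach) x↑)
    w↓ : Downstream j w
    w↓ = ≼-trans (strand-unique j) y↓ y≼w

  source-upstream : ∀ {k} → Upstream k s
  source-upstream {k} = pathIn-head-≼ (strand-path k) (≺⇒∈ˡ (failure-≺ k))

  target-downstream : ∀ {k} → Downstream k t
  target-downstream {k} = pathIn-≼-last (strand-path k) (strand-unique k) (≺⇒∈ʳ (failure-≺ k))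

  reach-avoiding-failures : ∀ {r} → PathIn GF s t r → Reach HF s t
  reach-avoiding-failures p
    with crossing someUpstream? someDownstream? p (Fin.zero , source-upstream) (Fin.zero , target-downstream)
  ... | inj₁ (w , (_ , w↑) , (_ , w↓)) = reach-via (proj₂ (upstream-path w↑)) (proj₂ (downstream-path w↓))
  ... | inj₂ (x , y , (_ , x↑) , (_ , y↓) , segment , seg) =
    coupled x↑ y↓ (reach⇒disjReach (shortcut (pathIn-retype offStrands seg)))
    where
    offStrands : ∀ {e} → e ∈ edgesOf segment → OffStrands e
    offStrands e∈ = let gf , crossingEdge = pathIn-edge seg e∈ in
      proj₁ gf , crossingEdge-offStrands gf crossingEdge

module _ {A : Set} where

  at-most-two : ∀ {xs : List A} {x y} → length xs ≤ 2 → x ∈ xs → y ∈ xs → x ≢ y →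
                ∀ {z} → z ∈ xs → z ≡ x ⊎ z ≡ y
  at-most-two {_ ∷ []} _ (here refl) (here refl) x≢y = ⊥-elim (x≢y refl)
  at-most-two {_ ∷ _ ∷ []} _ (here refl) (here refl) x≢y = ⊥-elim (x≢y refl)
  at-most-two {_ ∷ _ ∷ []} _ (there (here refl)) (there (here refl)) x≢y = ⊥-elim (x≢y refl)
  at-most-two {_ ∷ _ ∷ []} _ (here refl) (there (here refl)) _ (here refl) = inj₁ refl
  at-most-two {_ ∷ _ ∷ []} _ (here refl) (there (here refl)) _ (there (here refl)) = inj₂ refl
  at-most-two {_ ∷ _ ∷ []} _ (there (here refl)) (here refl) _ (here refl) = inj₂ refl
  at-most-two {_ ∷ _ ∷ []} _ (there (here refl)) (here refl) _ (there (here refl)) = inj₁ refl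
  at-most-two {_ ∷ _ ∷ _ ∷ _} (s≤s (s≤s ())) _ _ _

module FaultTolerance {n : ℕ} (E : List (Edge n)) (s t : Fin n) (P : Fin 2 → List (Fin n))
                      (strands : Strands.OuterStrands E s t P)
                      (Q : Fin 2 → Fin n → List (Fin n)) (paths : Strands.CouplingPaths E s t P Q)
                      (F : List (Edge n)) (|F|≤2 : length F ≤ 2) where
  open Strands E s t P
  open OuterStrandFacts E s t P strands
  open CouplingPathFacts E s t P strands Q paths
  open DecMembership (≡-dec (_≟_ {n}) (_≟_ {n})) using (_∈?_)

  H⊆G : ∀ {e} → H Q e → G E s t e
  H⊆G (inj₁ (k , e∈)) = pathIn-edge (strand-path k) e∈
  H⊆G (inj₂ (_ , _ , _ , _ , v∈ , c , e∈ , _)) = proj₁ (pathIn-edge (couplingPath v∈ c) e∈)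

  reach-H⇒G : Reach (H Q ∖ F) s t → Reach (G E s t ∖ F) s t
  reach-H⇒G (vs , p , vs!) =
    vs , pathIn-retype (λ e∈ → let h , e∉F = pathIn-edge p e∈ in H⊆G h , e∉F) p , vs!

  intact-strand : ∀ k → ¬ Any (_∈ F) (edgesOf (P k)) → Reach (H Q ∖ F) s t
  intact-strand k intact =
    P k , pathIn-retype (λ e∈ → inj₁ (k , e∈) , λ e∈F → intact (lose e∈ e∈F)) (strand-path k) , strand-unique k

  module _ {r} (p : PathIn (G E s t ∖ F) s t r) (r! : Unique r) where

    failed-not-cut : ∀ {e} → e ∈ F → ¬ CutEdge E s t e
    failed-not-cut e∈F (_ , on-every-path) =
      proj₂ (pathIn-edge p (on-every-path r (pathIn-retype (λ e∈ → proj₁ (pathIn-edge p e∈)) p , r!))) e∈F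

    failed-on-one-strand : ∀ {e} → e ∈ F → e ∈ edgesOf (P Fin.zero) → e ∉ edgesOf (P (Fin.suc Fin.zero))
    failed-on-one-strand e∈F e∈₀ e∈₁ = failed-not-cut e∈F (proj₂ (proj₂ strands) _ e∈₀ e∈₁)

    both-strands-hit : Any (_∈ F) (edgesOf (P Fin.zero)) → Any (_∈ F) (edgesOf (P (Fin.suc Fin.zero))) →
                       Reach (H Q ∖ F) s t
    both-strands-hit hit₀ hit₁ with find hit₀ | find hit₁
    ... | e₀ , e₀∈ , e₀∈F | e₁ , e₁∈ , e₁∈F =
      TwoFailures.reach-avoiding-failures E s t P strands Q paths F failedEdge
        failed-on-strand failed only-failed failed-exclusive p
      where
      e₀∉₁ : e₀ ∉ edgesOf (P (Fin.suc Fin.zero))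
      e₀∉₁ = failed-on-one-strand e₀∈F e₀∈
      e₁∉₀ : e₁ ∉ edgesOf (P Fin.zero)
      e₁∉₀ e₁∈₀ = failed-on-one-strand e₁∈F e₁∈₀ e₁∈
      failedEdge : Fin 2 → Edge n
      failedEdge Fin.zero = e₀
      failedEdge (Fin.suc Fin.zero) = e₁
      failed-on-strand : ∀ k → failedEdge k ∈ edgesOf (P k)
      failed-on-strand Fin.zero = e₀∈
      failed-on-strand (Fin.suc Fin.zero) = e₁∈
      failed : ∀ k → failedEdge k ∈ F
      failed Fin.zero = e₀∈F
      failed (Fin.suc Fin.zero) = e₁∈F
      failed-exclusive : ∀ {k l} → failedEdge k ∈ edgesOf (P l) → k ≡ l
      failed-exclusive {Fin.zero} {Fin.zero} _ = refl
      failed-exclusive {Fin.zero} {Fin.suc Fin.zero} e₀∈₁ = ⊥-elim (e₀∉₁ e₀∈₁)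
      failed-exclusive {Fin.suc Fin.zero} {Fin.zero} e₁∈₀ = ⊥-elim (e₁∉₀ e₁∈₀)
      failed-exclusive {Fin.suc Fin.zero} {Fin.suc Fin.zero} _ = refl
      only-failed : ∀ {e} → e ∈ F → ∃ λ k → e ≡ failedEdge k
      only-failed e∈F with at-most-two |F|≤2 e₀∈F e₁∈F (λ { refl → e₀∉₁ e₁∈ }) e∈F
      ... | inj₁ e≡e₀ = Fin.zero , e≡e₀
      ... | inj₂ e≡e₁ = Fin.suc Fin.zero , e≡e₁

  reach-G⇒H : Reach (G E s t ∖ F) s t → Reach (H Q ∖ F) s t
  reach-G⇒H (_ , p , r!)
    with any? (_∈? F) (edgesOf (P Fin.zero)) | any? (_∈? F) (edgesOf (P (Fin.suc Fin.zero)))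
  ... | no intact | _ = intact-strand Fin.zero intact
  ... | yes _ | no intact = intact-strand (Fin.suc Fin.zero) intact
  ... | yes hit₀ | yes hit₁ = both-strands-hit p r! hit₀ hit₁

lemma3p1 : Σ ℕ λ c →
    ∀ (n : ℕ) (E : List (Edge n)) (s t : Fin n) →
    Reach (G E s t) s t →
    (P : Fin 2 → List (Fin n)) → Strands.OuterStrands E s t P →
    (Q : Fin 2 → Fin n → List (Fin n)) → Strands.CouplingPaths E s t P Q →
    ((F : List (Edge n)) → All (λ e → e ∈ E) F → length F ≤ 2 →
       (Reach (G E s t ∖ F) s t ⇔ Reach (Strands.H E s t P Q ∖ F) s t))
    ×
    ((L : List (Edge n)) → Unique L → All (Strands.H E s t P Q) L →
       length L ≤ c * n)
lemma3p1 = 6 , λ n E s t _ P strands Q paths →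
  (λ F _ |F|≤2 → let open FaultTolerance E s t P strands Q paths F |F|≤2 in mk⇔ reach-G⇒H reach-H⇒G) ,
  λ L L! inH → CouplingPathFacts.H-size E s t P strands Q paths L! inH
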